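{- Let $a\geq 4$ and $m\geq a^2-a+2$ be integers, let $C(m,a)=\left\lceil\frac{m-1}{a}\left\lceil\frac{m-1}{a}\right\rceil\right\rceil$, and suppose the set $\{1,\dots,C(m,a)\}$ is colored red and blue so that there is no solution of $x_1+\cdots+x_{m-1}=ax_m$ with all $x_i\in\{1,\dots,C(m,a)\}$ of the same color. Suppose further that $a-2$ and $a-1$ are both red. If $d$ is an integer such that $a\mid d$ and $m-1\leq d\leq a(m-1)$, then $\frac{d}{a}$ is blue.
   Context: Solutions need not have distinct entries. -}

module Defs where

open import Data.Nat using (ℕ; zero; suc; _+_; _*_; _∸_; _≤_; NonZero)
open import Data.Nat.DivMod using (_/_)
open import Data.Bool using (Bool)
open import Data.Fin using (Fin; zero; suc)
open import Data.Product using (Σ; _×_)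
open import Relation.Binary.PropositionalEquality using (_≡_)

⌈_/_⌉ : ℕ → (a : ℕ) → .{{NonZero a}} → ℕ
⌈ n / a ⌉ = (n + (a ∸ 1)) / a

∑ : (k : ℕ) → (Fin k → ℕ) → ℕ
∑ zero    x = 0
∑ (suc k) x = x zero + ∑ k (λ i → x (suc i))

-- C(m,a) = ⌈ ((m-1)/a) · ⌈(m-1)/a⌉ ⌉ ; since ⌈(m-1)/a⌉ is an integer,
-- this equals ⌈ ((m-1) · ⌈(m-1)/a⌉) / a ⌉
C : (m a : ℕ) → .{{NonZero a}} → ℕ
C m a = ⌈ (m ∸ 1) * ⌈ (m ∸ 1) / a ⌉ / a ⌉

-- A 2-colouring of the positive integers (only values on 1..N matter);
-- true = red, false = blue.
Colouring : Set
Colouring = ℕ → Bool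

MonoSolution : (m a N : ℕ) → Colouring → Set
MonoSolution m a N χ =
  Σ (Fin (m ∸ 1) → ℕ) λ x → Σ ℕ λ xm → Σ Bool λ col →
    ((i : Fin (m ∸ 1)) → (1 ≤ x i) × (x i ≤ N) × (χ (x i) ≡ col)) ×
    (1 ≤ xm) × (xm ≤ N) × (χ xm ≡ col) ×
    (∑ (m ∸ 1) x ≡ a * xm)

-- Write a = 4 + b and n = m - 1. A colouring without monochromatic solution forbids n terms of one
-- colour summing to a·y with y of that colour. Since a-2 and a-1 are red, their n-term sums fill
-- [n(a-2), n(a-1)], so every y with a·y in that range is blue: a blue interval [L, U] of length > a-2.
-- If a were blue, n copies of a would force n to be red, and then n, n and n-2 terms from {a-2, a-1}
-- would be a red solution with y = n. If some i ≤ a-3 were blue, then i, repeated all but a-i or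
-- a-i-1 times, padded with terms of [L, U], hits a·y for a blue y in [L, U]. Hence 1, …, a are red,
-- their n-term sums fill [n, a·n], and so d/a is blue whenever n ≤ d ≤ a·n.
module Submission where

open import Defs
open import Data.Nat using (ℕ; zero; suc; _*_; _∸_; _+_; _≤_; _<_; _/_; _%_; _≤?_; NonZero; >-nonZero; s≤s; z≤n; s≤s⁻¹)
open import Data.Nat.Properties
open import Data.Nat.DivMod using (m≡m%n+[m/n]*n; m%n<n; m/n*n≤m; m*n/n≡m; /-monoˡ-≤; m<n*o⇒m/o<n)
open import Data.Nat.Divisibility using (_∣_; divides)
open import Data.Nat.Tactic.RingSolver using (solve)
open import Data.Bool using (Bool; true; false; not)
open import Data.Bool.Properties using (¬-not)
open import Data.Fin using (Fin; zero; suc)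
open import Data.List using ([]; _∷_)
open import Data.Vec.Functional using (tail) renaming (_∷_ to _◂_)
open import Data.Product using (_,_)
open import Data.Sum using (inj₁; inj₂)
open import Data.Empty using (⊥)
open import Function using (_∘_)
open import Relation.Nullary using (¬_; yes; no; contradiction)
open import Relation.Binary.PropositionalEquality using (_≡_; _≢_; refl; sym; trans; cong; subst)

open ≤-Reasoning

m≤m/n*n+[n∸1] : ∀ m n .{{_ : NonZero n}} → m ≤ m / n * n + (n ∸ 1)
m≤m/n*n+[n∸1] m n@(suc n-1) = begin
  m                      ≡⟨ m≡m%n+[m/n]*n m n ⟩
  m % n + m / n * n      ≤⟨ +-monoˡ-≤ (m / n * n) (s≤s⁻¹ (m%n<n m n)) ⟩
  n-1 + m / n * n        ≡⟨ +-comm n-1 (m / n * n) ⟩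
  m / n * n + n-1        ∎

⌈m/n⌉*n≤m+[n∸1] : ∀ m n .{{_ : NonZero n}} → ⌈ m / n ⌉ * n ≤ m + (n ∸ 1)
⌈m/n⌉*n≤m+[n∸1] m n = m/n*n≤m (m + (n ∸ 1)) n

m≤⌈m/n⌉*n : ∀ m n .{{_ : NonZero n}} → m ≤ ⌈ m / n ⌉ * n
m≤⌈m/n⌉*n m n = +-cancelʳ-≤ (n ∸ 1) m _ (m≤m/n*n+[n∸1] (m + (n ∸ 1)) n)

⌈/⌉-monoˡ-≤ : ∀ {m o} n .{{_ : NonZero n}} → m ≤ o → ⌈ m / n ⌉ ≤ ⌈ o / n ⌉
⌈/⌉-monoˡ-≤ n m≤o = /-monoˡ-≤ n (+-monoˡ-≤ (n ∸ 1) m≤o)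

m≤o*n⇒⌈m/n⌉≤o : ∀ {m o} n .{{_ : NonZero n}} → m ≤ o * n → ⌈ m / n ⌉ ≤ o
m≤o*n⇒⌈m/n⌉≤o {m} {o} n@(suc n-1) m≤o*n = s≤s⁻¹ (m<n*o⇒m/o<n (begin-strict
  m + n-1         ≤⟨ +-monoˡ-≤ n-1 m≤o*n ⟩
  o * n + n-1     <⟨ +-monoʳ-< (o * n) (n<1+n n-1) ⟩
  o * n + n       ≡⟨ +-comm (o * n) n ⟩
  suc o * n       ∎))

m*n<o⇒m<⌈o/n⌉ : ∀ {m o} n .{{_ : NonZero n}} → m * n < o → m < ⌈ o / n ⌉
m*n<o⇒m<⌈o/n⌉ {m} {o} n m*n<o = *-cancelʳ-< n m _ (<-≤-trans m*n<o (m≤⌈m/n⌉*n o n))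

m∸1≤C[m,a] : ∀ m a .{{_ : NonZero a}} → a * (a ∸ 1) < m ∸ 1 → m ∸ 1 ≤ C m a
m∸1≤C[m,a] m a@(suc a-1) large = *-cancelʳ-≤ (m ∸ 1) (C m a) a (begin
  (m ∸ 1) * a                   ≤⟨ *-monoʳ-≤ (m ∸ 1) a≤⌈n/a⌉ ⟩
  (m ∸ 1) * ⌈ (m ∸ 1) / a ⌉     ≤⟨ m≤⌈m/n⌉*n _ a ⟩
  C m a * a                     ∎)
  where
  a≤⌈n/a⌉ : a ≤ ⌈ (m ∸ 1) / a ⌉
  a≤⌈n/a⌉ = m*n<o⇒m<⌈o/n⌉ a (subst (_< m ∸ 1) (*-comm a a-1) large)

m+2≤n⇒m<n∸1 : ∀ {m n} → m + 2 ≤ n → m < n ∸ 1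
m+2≤n⇒m<n∸1 {m} {n} h = subst (_≤ n ∸ 1) (trans (+-∸-assoc m (s≤s z≤n)) (+-comm m 1)) (∸-monoˡ-≤ 1 h)

m*n>0⇒n>0 : ∀ m {n} → 0 < m * n → 0 < n
m*n>0⇒n>0 m {zero}  m*0>0 = contradiction (subst (0 <_) (*-zeroʳ m) m*0>0) (λ ())
m*n>0⇒n>0 m {suc n} _     = s≤s z≤n

-- The bounds are stated for a = 4 + b, i.e. with a ∸ 1 = 3 + b and a ∸ 2 = 2 + b unfolded, as the
-- ring solver needs.
module Bounds where

  2n+[n∸2][a∸2]≤an : ∀ b n → 2 * n + (n ∸ 2) * (2 + b) ≤ (4 + b) * n
  2n+[n∸2][a∸2]≤an b n = begin
    2 * n + (n ∸ 2) * (2 + b)  ≤⟨ +-monoʳ-≤ (2 * n) (*-monoˡ-≤ (2 + b) (m∸n≤m n 2)) ⟩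
    2 * n + n * (2 + b)        ≡⟨ solve (b ∷ n ∷ []) ⟩
    (4 + b) * n                ∎

  an≤2n+[n∸2][a∸1] : ∀ b n → (4 + b) * (3 + b) < n → (4 + b) * n ≤ 2 * n + (n ∸ 2) * (3 + b)
  an≤2n+[n∸2][a∸1] b 1 (s≤s ())
  an≤2n+[n∸2][a∸1] b (suc (suc k)) large = begin
    (4 + b) * (2 + k)                           ≡⟨ solve (b ∷ k ∷ []) ⟩
    2 * (2 + k) + (2 * (2 + b) + k * (2 + b))   ≤⟨ +-monoʳ-≤ (2 * (2 + k)) (+-monoˡ-≤ (k * (2 + b)) 2[2+b]≤k) ⟩
    2 * (2 + k) + (k + k * (2 + b))             ≡⟨ cong (2 * (2 + k) +_) (sym (*-suc k (2 + b))) ⟩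
    2 * (2 + k) + k * (3 + b)                   ∎
    where
    2[2+b]≤k : 2 * (2 + b) ≤ k
    2[2+b]≤k = +-cancelˡ-≤ 2 _ _ (begin
      2 + 2 * (2 + b)    ≡⟨ solve (b ∷ []) ⟩
      2 * (3 + b)        ≤⟨ *-monoˡ-≤ (3 + b) (m≤m+n 2 (2 + b)) ⟩
      (4 + b) * (3 + b)  ≤⟨ <⇒≤ large ⟩
      2 + k              ∎)

  U+[a∸1]≤n : ∀ b n U → U * (4 + b) ≤ n * (3 + b) → (4 + b) * (3 + b) < n → U + (3 + b) ≤ n
  U+[a∸1]≤n b n U hU large = *-cancelʳ-≤ (U + (3 + b)) n (4 + b) (begin
    (U + (3 + b)) * (4 + b)          ≡⟨ *-distribʳ-+ (4 + b) U (3 + b) ⟩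
    U * (4 + b) + (3 + b) * (4 + b)  ≤⟨ +-mono-≤ hU (subst (_≤ n) (*-comm (4 + b) (3 + b)) (<⇒≤ large)) ⟩
    n * (3 + b) + n                  ≡⟨ solve (b ∷ n ∷ []) ⟩
    n * (4 + b)                      ∎)

  L+[a∸2]≤U : ∀ b n L U → L * (4 + b) ≤ n * (2 + b) + (3 + b) → n * (3 + b) ≤ U * (4 + b) + (3 + b) →
              (4 + b) * (3 + b) < n → L + (2 + b) ≤ U
  L+[a∸2]≤U b n L U hL hU large =
    s≤s⁻¹ (*-cancelʳ-< (4 + b) (L + (2 + b)) (suc U) (+-cancelʳ-≤ (3 + b) _ _ (begin
      suc ((L + (2 + b)) * (4 + b)) + (3 + b)  ≡⟨ solve (b ∷ L ∷ []) ⟩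
      L * (4 + b) + (4 + b) * (3 + b)          ≤⟨ +-mono-≤ hL (<⇒≤ large) ⟩
      n * (2 + b) + (3 + b) + n                ≡⟨ solve (b ∷ n ∷ []) ⟩
      n * (3 + b) + (3 + b)                    ≤⟨ +-mono-≤ hU (n≤1+n (3 + b)) ⟩
      U * (4 + b) + (3 + b) + (4 + b)          ≡⟨ solve (b ∷ U ∷ []) ⟩
      suc U * (4 + b) + (3 + b)                ∎)))

  aU≤qi+[k+1]U : ∀ b i k q U → 3 + b ≡ i + k → U ≤ q → (4 + b) * U ≤ q * i + suc k * U
  aU≤qi+[k+1]U b i k q U split U≤q = begin
    (4 + b) * U          ≡⟨ cong (λ x → suc x * U) split ⟩
    suc (i + k) * U      ≡⟨ solve (i ∷ k ∷ U ∷ []) ⟩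
    i * U + suc k * U    ≤⟨ +-monoˡ-≤ (suc k * U) (subst (i * U ≤_) (*-comm i q) (*-monoʳ-≤ i U≤q)) ⟩
    q * i + suc k * U    ∎

  n[a∸2]≤[q+1]i+kL : ∀ b n i k q L U → (4 + b) * U ≤ q * i + suc k * L →
                     n * (3 + b) ≤ U * (4 + b) + (3 + b) → L + (3 + b) ≤ n →
                     n * (2 + b) ≤ suc q * i + k * L
  n[a∸2]≤[q+1]i+kL b n i k q L U low hU L+p≤n = +-cancelʳ-≤ n _ _ (begin
    n * (2 + b) + n                      ≡⟨ solve (b ∷ n ∷ []) ⟩
    n * (3 + b)                          ≤⟨ hU ⟩
    U * (4 + b) + (3 + b)                ≡⟨ cong (_+ (3 + b)) (*-comm U (4 + b)) ⟩
    (4 + b) * U + (3 + b)                ≤⟨ +-monoˡ-≤ (3 + b) low ⟩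
    q * i + suc k * L + (3 + b)          ≤⟨ m≤n+m _ i ⟩
    i + (q * i + suc k * L + (3 + b))    ≡⟨ solve (b ∷ i ∷ k ∷ q ∷ L ∷ []) ⟩
    suc q * i + k * L + (L + (3 + b))    ≤⟨ +-monoʳ-≤ (suc q * i + k * L) L+p≤n ⟩
    suc q * i + k * L + n                ∎)

  q'i+kL≤Ua : ∀ b n i k q' L U → 3 + b ≡ i + k → q' + k ≡ n → 1 ≤ k → (4 + b) * (3 + b) < n →
              L * (4 + b) ≤ n * (2 + b) + (3 + b) → n * (3 + b) ≤ U * (4 + b) + (3 + b) →
              q' * i + k * L ≤ U * (4 + b)
  q'i+kL≤Ua b n i k q' L U split refl 1≤k large hL hU =
    *-cancelˡ-≤ (4 + b) (+-cancelʳ-≤ ((4 + b) * (3 + b)) _ _ (begin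
      (4 + b) * (q' * i + k * L) + (4 + b) * (3 + b)
                                            ≡⟨ solve (b ∷ q' ∷ i ∷ k ∷ L ∷ []) ⟩
      (4 + b) * (q' * i) + k * (L * (4 + b)) + (4 + b) * (3 + b)
                                            ≤⟨ +-monoˡ-≤ _ (+-monoʳ-≤ ((4 + b) * (q' * i)) (*-monoʳ-≤ k hL)) ⟩
      (4 + b) * (q' * i) + k * (n * (2 + b) + (3 + b)) + (4 + b) * (3 + b)
                                            ≡⟨ solve (b ∷ q' ∷ i ∷ k ∷ []) ⟩
      (4 + b) * (q' * i) + k * (n * (2 + b)) + (k * (3 + b) + (4 + b) * (3 + b))
                                            ≤⟨ +-monoʳ-≤ ((4 + b) * (q' * i) + k * (n * (2 + b))) k[a∸1]+a[a∸1]≤kn+kn ⟩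
      (4 + b) * (q' * i) + k * (n * (2 + b)) + (k * n + k * n)
                                            ≤⟨ m≤m+n _ ((4 + b) * (k * i)) ⟩
      (4 + b) * (q' * i) + k * (n * (2 + b)) + (k * n + k * n) + (4 + b) * (k * i)
                                            ≡⟨ solve (b ∷ q' ∷ i ∷ k ∷ []) ⟩
      (4 + b) * (n * (i + k))               ≡⟨ cong (λ x → (4 + b) * (n * x)) (sym split) ⟩
      (4 + b) * (n * (3 + b))               ≤⟨ *-monoʳ-≤ (4 + b) hU ⟩
      (4 + b) * (U * (4 + b) + (3 + b))     ≡⟨ *-distribˡ-+ (4 + b) (U * (4 + b)) (3 + b) ⟩
      (4 + b) * (U * (4 + b)) + (4 + b) * (3 + b) ∎))
    where
    k[a∸1]+a[a∸1]≤kn+kn : k * (3 + b) + (4 + b) * (3 + b) ≤ k * n + k * n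
    k[a∸1]+a[a∸1]≤kn+kn = +-mono-≤ (*-monoʳ-≤ k (≤-trans (m≤n*m (3 + b) (4 + b)) (<⇒≤ large)))
                                   (≤-trans (<⇒≤ large) (m≤n*m n k {{>-nonZero 1≤k}}))

  kL+[a∸1]≤kU : ∀ b k L U → 2 ≤ k → L + (2 + b) ≤ U → k * L + (3 + b) ≤ k * U
  kL+[a∸1]≤kU b k L U 2≤k gap = begin
    k * L + (3 + b)        ≤⟨ +-monoʳ-≤ (k * L) a∸1≤k[a∸2] ⟩
    k * L + k * (2 + b)    ≡⟨ sym (*-distribˡ-+ k L (2 + b)) ⟩
    k * (L + (2 + b))      ≤⟨ *-monoʳ-≤ k gap ⟩
    k * U                  ∎
    where
    a∸1≤k[a∸2] : 3 + b ≤ k * (2 + b)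
    a∸1≤k[a∸2] = begin
      3 + b                ≤⟨ m≤m+n (3 + b) (1 + b) ⟩
      3 + b + (1 + b)      ≡⟨ solve (b ∷ []) ⟩
      2 * (2 + b)          ≤⟨ *-monoˡ-≤ (2 + b) 2≤k ⟩
      k * (2 + b)          ∎

module _ (χ : Colouring) (N : ℕ) where

  record Coloured (c : Bool) (y : ℕ) : Set where
    constructor coloured
    field
      positive : 1 ≤ y
      bounded  : y ≤ N
      colour   : χ y ≡ c

  Monochromatic : Bool → ℕ → ℕ → Set
  Monochromatic c lo hi = ∀ {y} → lo ≤ y → y ≤ hi → Coloured c y

  point : ∀ {c x} → Coloured c x → Monochromatic c x x
  point {c} cx x≤y y≤x = subst (Coloured c) (≤-antisym x≤y y≤x) cx

  extend : ∀ {c lo hi} → Monochromatic c lo hi → Coloured c (suc hi) → Monochromatic c lo (suc hi)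
  extend mono c-next lo≤y y≤hi+1 with m≤n⇒m<n∨m≡n y≤hi+1
  ... | inj₁ y≤hi = mono lo≤y (s≤s⁻¹ y≤hi)
  ... | inj₂ refl = c-next

  record Sum (c : Bool) (k T : ℕ) : Set where
    constructor sum
    field
      term        : Fin k → ℕ
      term-colour : ∀ j → Coloured c (term j)
      total       : ∑ k term ≡ T

  []ₛ : ∀ {c} → Sum c 0 0
  []ₛ = sum (λ ()) (λ ()) refl

  infixr 5 _∷ₛ_ _++ₛ_

  _∷ₛ_ : ∀ {c k v T} → Coloured c v → Sum c k T → Sum c (suc k) (v + T)
  _∷ₛ_ {v = v} cv (sum x cx Σx) = sum (v ◂ x) colour (cong (v +_) Σx)
    where
    colour : ∀ j → Coloured _ ((v ◂ x) j)
    colour zero    = cv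
    colour (suc j) = cx j

  _++ₛ_ : ∀ {c k₁ k₂ T₁ T₂} → Sum c k₁ T₁ → Sum c k₂ T₂ → Sum c (k₁ + k₂) (T₁ + T₂)
  _++ₛ_ {k₁ = zero}  (sum x cx refl) s = s
  _++ₛ_ {k₁ = suc k} (sum x cx refl) s =
    subst (Sum _ _) (sym (+-assoc (x zero) _ _)) (cx zero ∷ₛ sum (tail x) (cx ∘ suc) refl ++ₛ s)

  replicateₛ : ∀ {c v} k → Coloured c v → Sum c k (k * v)
  replicateₛ zero    cv = []ₛ
  replicateₛ (suc k) cv = cv ∷ₛ replicateₛ k cv

  intervalₛ : ∀ {c lo hi} → Monochromatic c lo hi → lo ≤ hi →
              ∀ k {T} → k * lo ≤ T → T ≤ k * hi → Sum c k T
  intervalₛ mono lo≤hi zero {T} _ T≤0 = subst (Sum _ 0) (sym (n≤0⇒n≡0 T≤0)) []ₛ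
  intervalₛ {c} {lo} {hi} mono lo≤hi (suc k) {T} lo≤T T≤hi with T ≤? lo + k * hi
  ... | yes T≤lo+k*hi =
    subst (Sum c (suc k)) (m+[n∸m]≡n (≤-trans (m≤m+n lo (k * lo)) lo≤T))
      (mono ≤-refl lo≤hi ∷ₛ intervalₛ mono lo≤hi k
        (m+n≤o⇒m≤o∸n (k * lo) (subst (_≤ T) (+-comm lo (k * lo)) lo≤T))
        (m≤n+o⇒m∸n≤o T lo T≤lo+k*hi))
  ... | no T≰lo+k*hi =
    subst (Sum c (suc k)) (m∸n+n≡m (≤-trans (m≤n+m (k * hi) lo) (<⇒≤ lo+k*hi<T)))
      (mono (m+n≤o⇒m≤o∸n lo (<⇒≤ lo+k*hi<T))
            (m≤n+o⇒m∸n≤o T (k * hi) (subst (T ≤_) (+-comm hi (k * hi)) T≤hi))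
       ∷ₛ replicateₛ k (mono lo≤hi ≤-refl))
    where lo+k*hi<T = ≰⇒> T≰lo+k*hi

  mixedₛ : ∀ {c v lo hi} → Coloured c v → Monochromatic c lo hi → lo ≤ hi →
           ∀ q r {T} → q * v + r * lo ≤ T → T ≤ q * v + r * hi → Sum c (q + r) T
  mixedₛ {c} {v} {lo} cv mono lo≤hi q r {T} lower upper =
    subst (Sum c (q + r)) (m+[n∸m]≡n (≤-trans (m≤m+n (q * v) (r * lo)) lower))
      (replicateₛ q cv ++ₛ intervalₛ mono lo≤hi r
        (m+n≤o⇒m≤o∸n (r * lo) (subst (_≤ T) (+-comm (q * v) (r * lo)) lower))
        (m≤n+o⇒m∸n≤o T (q * v) upper))

  solution : ∀ {m a c y} → Sum c (m ∸ 1) (a * y) → Coloured c y → MonoSolution m a N χ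
  solution (sum x cx Σx) (coloured 1≤y y≤N χy≡c) =
    x , _ , _ , (λ j → let open Coloured (cx j) in positive , bounded , colour) , 1≤y , y≤N , χy≡c , Σx

  module ForcedColours (b n : ℕ) (large : (4 + b) * (3 + b) < n) (n≤N : n ≤ N)
    (no-mono : ∀ {c y} → Sum c n ((4 + b) * y) → Coloured c y → ⊥)
    (χ[a∸2] : χ (2 + b) ≡ true) (χ[a∸1] : χ (3 + b) ≡ true) where

    a≤n : 4 + b ≤ n
    a≤n = ≤-trans (m≤m*n (4 + b) (3 + b)) (<⇒≤ large)

    1≤n : 1 ≤ n
    1≤n = ≤-trans (s≤s z≤n) a≤n

    coloured≤a : ∀ {c y} → 1 ≤ y → y ≤ 4 + b → χ y ≡ c → Coloured c y
    coloured≤a 1≤y y≤a = coloured 1≤y (≤-trans y≤a (≤-trans a≤n n≤N))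

    opposite-colour : ∀ {c y} → Sum c n ((4 + b) * y) → 1 ≤ y → y ≤ N → χ y ≡ not c
    opposite-colour s 1≤y y≤N = ¬-not (λ χy≡c → no-mono s (coloured 1≤y y≤N χy≡c))

    red[a∸2] : Coloured true (2 + b)
    red[a∸2] = coloured≤a (s≤s z≤n) (≤-trans (n≤1+n _) (n≤1+n _)) χ[a∸2]

    red[a∸1] : Coloured true (3 + b)
    red[a∸1] = coloured≤a (s≤s z≤n) (n≤1+n _) χ[a∸1]

    red[a∸2,a∸1] : Monochromatic true (2 + b) (3 + b)
    red[a∸2,a∸1] = extend (point red[a∸2]) red[a∸1]

    blue-between : ∀ {y} → n * (2 + b) ≤ (4 + b) * y → (4 + b) * y ≤ n * (3 + b) →
                   1 ≤ y → y ≤ N → χ y ≡ false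
    blue-between lower upper = opposite-colour (intervalₛ red[a∸2,a∸1] (n≤1+n _) n lower upper)

    red[a] : χ (4 + b) ≡ true
    red[a] = ¬-not a-not-blue
      where
      a-not-blue : χ (4 + b) ≢ false
      a-not-blue a-blue = no-mono (subst (λ k → Sum true k ((4 + b) * n)) (m+[n∸m]≡n 2≤n) two-n+rest) n-red
        where
        2≤n : 2 ≤ n
        2≤n = ≤-trans (s≤s (s≤s z≤n)) a≤n
        n-red : Coloured true n
        n-red = coloured 1≤n n≤N (opposite-colour (subst (Sum false n) (*-comm n (4 + b))
                  (replicateₛ n (coloured≤a (s≤s z≤n) ≤-refl a-blue))) 1≤n n≤N)
        two-n+rest : Sum true (2 + (n ∸ 2)) ((4 + b) * n)
        two-n+rest = mixedₛ n-red red[a∸2,a∸1] (n≤1+n _) 2 (n ∸ 2)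
                       (Bounds.2n+[n∸2][a∸2]≤an b n) (Bounds.an≤2n+[n∸2][a∸1] b n large)

    L U : ℕ
    L = ⌈ n * (2 + b) / (4 + b) ⌉
    U = n * (3 + b) / (4 + b)

    n[a∸2]≤La : n * (2 + b) ≤ L * (4 + b)
    n[a∸2]≤La = m≤⌈m/n⌉*n (n * (2 + b)) (4 + b)

    La≤n[a∸2]+[a∸1] : L * (4 + b) ≤ n * (2 + b) + (3 + b)
    La≤n[a∸2]+[a∸1] = ⌈m/n⌉*n≤m+[n∸1] (n * (2 + b)) (4 + b)

    Ua≤n[a∸1] : U * (4 + b) ≤ n * (3 + b)
    Ua≤n[a∸1] = m/n*n≤m (n * (3 + b)) (4 + b)

    n[a∸1]≤Ua+[a∸1] : n * (3 + b) ≤ U * (4 + b) + (3 + b)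
    n[a∸1]≤Ua+[a∸1] = m≤m/n*n+[n∸1] (n * (3 + b)) (4 + b)

    L+[a∸2]≤U : L + (2 + b) ≤ U
    L+[a∸2]≤U = Bounds.L+[a∸2]≤U b n L U La≤n[a∸2]+[a∸1] n[a∸1]≤Ua+[a∸1] large

    L≤U : L ≤ U
    L≤U = m+n≤o⇒m≤o L L+[a∸2]≤U

    U+[a∸1]≤n : U + (3 + b) ≤ n
    U+[a∸1]≤n = Bounds.U+[a∸1]≤n b n U Ua≤n[a∸1] large

    blue[L,U] : Monochromatic false L U
    blue[L,U] {y} L≤y y≤U = coloured 1≤y y≤N (blue-between lower upper 1≤y y≤N)
      where
      lower : n * (2 + b) ≤ (4 + b) * y
      lower = ≤-trans n[a∸2]≤La (subst (L * (4 + b) ≤_) (*-comm y (4 + b)) (*-monoˡ-≤ (4 + b) L≤y))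
      upper : (4 + b) * y ≤ n * (3 + b)
      upper = ≤-trans (subst (_≤ U * (4 + b)) (*-comm y (4 + b)) (*-monoˡ-≤ (4 + b) y≤U)) Ua≤n[a∸1]
      1≤y : 1 ≤ y
      1≤y = m*n>0⇒n>0 (4 + b) (≤-trans (≤-trans 1≤n (m≤m*n n (2 + b))) lower)
      y≤N : y ≤ N
      y≤N = ≤-trans y≤U (≤-trans (m+n≤o⇒m≤o U U+[a∸1]≤n) n≤N)

    module SmallBlue {i k : ℕ} (split : 3 + b ≡ i + k) (1≤i : 1 ≤ i) (2≤k : 2 ≤ k) (i-blue : χ i ≡ false) where

      blue-i : Coloured false i
      blue-i = coloured≤a 1≤i (≤-trans (m≤m+n i k) (subst (_≤ 4 + b) split (n≤1+n (3 + b)))) i-blue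

      k+1≤a∸1 : suc k ≤ 3 + b
      k+1≤a∸1 = subst (suc k ≤_) (sym split) (+-monoˡ-≤ k 1≤i)

      q : ℕ
      q = n ∸ suc k

      q+[k+1]≡n : q + suc k ≡ n
      q+[k+1]≡n = m∸n+n≡m (≤-trans k+1≤a∸1 (≤-trans (n≤1+n (3 + b)) a≤n))

      [q+1]+k≡n : suc q + k ≡ n
      [q+1]+k≡n = trans (sym (+-suc q k)) q+[k+1]≡n

      U≤q : U ≤ q
      U≤q = m+n≤o⇒m≤o∸n U (≤-trans (+-monoʳ-≤ U k+1≤a∸1) U+[a∸1]≤n)

      -- Either q copies of i and k+1 blue terms already reach a·U, or they overshoot it, and then
      -- q+1 copies of i and k blue terms reach a·⌈s/a⌉ with ⌈s/a⌉ still in [L, U].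
      impossible : ⊥
      impossible with q * i + suc k * L ≤? (4 + b) * U
      ... | yes low≤aU =
        no-mono (subst (λ c → Sum false c ((4 + b) * U)) q+[k+1]≡n
                   (mixedₛ blue-i blue[L,U] L≤U q (suc k) low≤aU (Bounds.aU≤qi+[k+1]U b i k q U split U≤q)))
                (blue[L,U] L≤U ≤-refl)
      ... | no low≰aU =
        no-mono (subst (λ c → Sum false c ((4 + b) * X)) [q+1]+k≡n
                   (mixedₛ blue-i blue[L,U] L≤U (suc q) k s≤aX aX≤[q+1]i+kU))
                (blue[L,U] L≤X X≤U)
        where
        s : ℕ
        s = suc q * i + k * L
        X : ℕ
        X = ⌈ s / (4 + b) ⌉
        L≤X : L ≤ X
        L≤X = ⌈/⌉-monoˡ-≤ (4 + b) (Bounds.n[a∸2]≤[q+1]i+kL b n i k q L U (<⇒≤ (≰⇒> low≰aU)) n[a∸1]≤Ua+[a∸1]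
                (≤-trans (+-monoˡ-≤ (3 + b) L≤U) U+[a∸1]≤n))
        X≤U : X ≤ U
        X≤U = m≤o*n⇒⌈m/n⌉≤o (4 + b) (Bounds.q'i+kL≤Ua b n i k (suc q) L U split [q+1]+k≡n
                (≤-trans (s≤s z≤n) 2≤k) large La≤n[a∸2]+[a∸1] n[a∸1]≤Ua+[a∸1])
        s≤aX : s ≤ (4 + b) * X
        s≤aX = subst (s ≤_) (*-comm X (4 + b)) (m≤⌈m/n⌉*n s (4 + b))
        aX≤[q+1]i+kU : (4 + b) * X ≤ suc q * i + k * U
        aX≤[q+1]i+kU = begin
          (4 + b) * X                 ≡⟨ *-comm (4 + b) X ⟩
          X * (4 + b)                 ≤⟨ ⌈m/n⌉*n≤m+[n∸1] s (4 + b) ⟩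
          s + (3 + b)                 ≡⟨ +-assoc (suc q * i) (k * L) (3 + b) ⟩
          suc q * i + (k * L + (3 + b)) ≤⟨ +-monoʳ-≤ (suc q * i) (Bounds.kL+[a∸1]≤kU b k L U 2≤k L+[a∸2]≤U) ⟩
          suc q * i + k * U           ∎

    red[1,a∸3] : Monochromatic true 1 (1 + b)
    red[1,a∸3] {i} 1≤i i≤b+1 =
      coloured≤a 1≤i (≤-trans i≤b+1 (m≤n+m (1 + b) 3)) (¬-not (SmallBlue.impossible split 1≤i 2≤k))
      where
      k : ℕ
      k = (3 + b) ∸ i
      split : 3 + b ≡ i + k
      split = sym (m+[n∸m]≡n (≤-trans i≤b+1 (m≤n+m (1 + b) 2)))
      2≤k : 2 ≤ k
      2≤k = m+n≤o⇒m≤o∸n 2 (s≤s (s≤s i≤b+1))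

    red[1,a] : Monochromatic true 1 (4 + b)
    red[1,a] = extend (extend (extend red[1,a∸3] red[a∸2]) red[a∸1]) (coloured≤a (s≤s z≤n) ≤-refl red[a])

    blue-quotient : ∀ {y} → n ≤ (4 + b) * y → (4 + b) * y ≤ (4 + b) * n → χ y ≡ false
    blue-quotient {y} lower upper =
      opposite-colour
        (intervalₛ red[1,a] (s≤s z≤n) n (subst (_≤ (4 + b) * y) (sym (*-identityʳ n)) lower)
          (subst ((4 + b) * y ≤_) (*-comm (4 + b) n) upper))
        (m*n>0⇒n>0 (4 + b) (≤-trans 1≤n lower)) (≤-trans (*-cancelˡ-≤ (4 + b) upper) n≤N)

lemma5 : (a m : ℕ) → .{{_ : NonZero a}} → 4 ≤ a → (a * a ∸ a) + 2 ≤ m →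
    (χ : Colouring) →
    ¬ MonoSolution m a (C m a) χ →
    χ (a ∸ 2) ≡ true → χ (a ∸ 1) ≡ true →
    (d : ℕ) → a ∣ d → m ∸ 1 ≤ d → d ≤ a * (m ∸ 1) →
    χ (d / a) ≡ false
lemma5 a@(suc (suc (suc (suc b)))) m (s≤s (s≤s (s≤s (s≤s z≤n)))) m-large χ no-solution χ[a∸2] χ[a∸1]
       .(q * a) (divides q refl) lower upper =
  trans (cong χ (m*n/n≡m q a))
    (ForcedColours.blue-quotient χ (C m a) b (m ∸ 1) large (m∸1≤C[m,a] m a large)
      (λ s cy → no-solution (solution χ (C m a) {m} {a} s cy)) χ[a∸2] χ[a∸1]
      (subst (m ∸ 1 ≤_) (*-comm q a) lower) (subst (_≤ a * (m ∸ 1)) (*-comm q a) upper))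
  where
  large : a * (a ∸ 1) < m ∸ 1
  large = subst (_< m ∸ 1) (sym (trans (*-distribˡ-∸ a a 1) (cong (a * a ∸_) (*-identityʳ a)))) (m+2≤n⇒m<n∸1 m-large)
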